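{- Let $n\geq 2$ and let $a_1,\ldots,a_n$ be integers, and let $1\leq s\leq n-1$. If $\tau_{n,s}<n-s$, then there exists an integer $t$ with $1\leq t\leq n-s$ such that $d_s^t=0$.
   Context: Set $d_i^0=a_i$ for $1\leq i\leq n$, and for $k\geq 1$ define $d_j^k=|d_{j+1}^{k-1}-d_j^{k-1}|$ for $1\leq j\leq n-k$. The trace of the $s$-th segment is $\tau_{n,s}=\sum_{k=1}^{n-s}d_s^k$. -}

module Defs where

open import Data.Nat using (ℕ; zero; suc)
open import Data.Integer using (ℤ; _-_; +_) renaming (_+_ to _+ℤ_)
open import Data.Integer using () renaming (∣_∣ to abs)

absℤ : ℤ → ℤ
absℤ x = + abs x

-- Difference triangle of a sequence a (indexed by ℕ; only a 1 … a n matter):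
-- d a k j = d_j^k, with d_j^0 = a_j and d_j^k = |d_{j+1}^{k-1} - d_j^{k-1}|.
d : (ℕ → ℤ) → ℕ → ℕ → ℤ
d a zero    j = a j
d a (suc k) j = absℤ (d a k (suc j) - d a k j)

sumFrom1 : ℕ → (ℕ → ℤ) → ℤ
sumFrom1 zero    f = + 0
sumFrom1 (suc m) f = sumFrom1 m f +ℤ f (suc m)

τ : (ℕ → ℤ) → ℕ → ℕ → ℤ
τ a n s = sumFrom1 (n Data.Nat.∸ s) (λ k → d a k s)

{-# OPTIONS --safe #-}
-- Every d_s^k with k ≥ 1 is an absolute value, hence a natural number. If none of
-- d_s^1, …, d_s^(n-s) vanished, each would be at least 1 and the trace would be at
-- least n - s.
module Submission where

open import Defs
open import Data.Nat using (ℕ; _≤_; _∸_; zero; suc; z≤n; s≤s)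
import Data.Nat.Properties as ℕP
open import Data.Integer using (ℤ; +_; +≤+) renaming (_<_ to _<ℤ_; _≤_ to _≤ℤ_; _+_ to _+ℤ_)
import Data.Integer.Properties as ℤP
open import Data.Product using (Σ; _×_; _,_)
open import Data.Sum using (_⊎_; inj₁; inj₂)
open import Data.Empty using (⊥-elim)
open import Relation.Binary.PropositionalEquality using (_≡_; refl; sym; cong; subst)

d-suc-natural : (a : ℕ → ℤ) (k j : ℕ) → Σ ℕ (λ x → d a (suc k) j ≡ + x)
d-suc-natural a k j = _ , refl

sumFrom1-hasZero⊎≥length : (m : ℕ) (f : ℕ → ℤ) → (∀ k → Σ ℕ (λ x → f (suc k) ≡ + x)) →
  Σ ℕ (λ t → (1 ≤ t × t ≤ m) × f t ≡ + 0) ⊎ + m ≤ℤ sumFrom1 m f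
sumFrom1-hasZero⊎≥length zero    f natural = inj₂ (+≤+ z≤n)
sumFrom1-hasZero⊎≥length (suc m) f natural with natural m
... | zero  , fm≡0 = inj₁ (suc m , (s≤s z≤n , ℕP.≤-refl) , fm≡0)
... | suc x , fm≡1+x with sumFrom1-hasZero⊎≥length m f natural
...   | inj₁ (t , (1≤t , t≤m) , ft≡0) = inj₁ (t , (1≤t , ℕP.m≤n⇒m≤1+n t≤m) , ft≡0)
...   | inj₂ m≤sum = inj₂ (subst (_≤ℤ sumFrom1 m f +ℤ f (suc m)) (cong +_ (ℕP.+-comm m 1))
                            (ℤP.+-mono-≤ m≤sum 1≤fm))
  where
  1≤fm : + 1 ≤ℤ f (suc m)
  1≤fm = subst (+ 1 ≤ℤ_) (sym fm≡1+x) (+≤+ (s≤s z≤n))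

proposition4p8 : (n : ℕ) → 2 ≤ n → (a : ℕ → ℤ) → (s : ℕ) → 1 ≤ s → s ≤ n ∸ 1 →
    τ a n s <ℤ + (n ∸ s) →
    Σ ℕ (λ t → (1 ≤ t × t ≤ n ∸ s) × d a t s ≡ + 0)
proposition4p8 n _ a s _ _ τ<n-s
  with sumFrom1-hasZero⊎≥length (n ∸ s) (λ k → d a k s) (λ k → d-suc-natural a k s)
... | inj₁ zero-in-range = zero-in-range
... | inj₂ n-s≤τ         = ⊥-elim (ℤP.<⇒≱ τ<n-s n-s≤τ)
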